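{- For all positive integers $n$ and integers $t$ with $1\le t\le n$, $$\mathrm{D}(\mathsf{GHD}^n_{0,\, t}) = n - \log_2 V_2\left(n, \left\lfloor\tfrac{t}{2}\right\rfloor\right) + O(\log n),$$ where the $O(\log n)$ term is bounded in absolute value by $C\log n$ for an absolute constant $C$ (independent of $t$).
   Context: For $x,y\in\{0,1\}^n$, $H(x,y)=|\{i: x_i\ne y_i\}|$ is the Hamming distance. $\mathsf{GHD}^n_{0,t}$ is the partial Boolean function on $\{0,1\}^n\times\{0,1\}^n$ (Alice holds $x$, Bob holds $y$) with value $0$ if $x=y$ (i.e. $H(x,y)\le 0$), value $1$ if $H(x,y)\ge t$, and undefined otherwise. $\mathrm{D}(f)$ denotes the deterministic two-party communication complexity of a partial function $f$: the minimal depth of a deterministic protocol tree that outputs $f(x,y)$ on every input in the domain of $f$. $V_2(n,r)=\sum_{i=0}^{r}\binom{n}{i}$ is the size of a Hamming ball of radius $r$ in $\{0,1\}^n$. -}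

module Defs where

open import Data.Bool using (Bool; true; false; if_then_else_)
open import Data.Nat using (ℕ; zero; suc; _+_; _*_; _^_; _⊔_; _≤_)
open import Data.Nat.Combinatorics using (_C_)
open import Data.Vec using (Vec; []; _∷_)
open import Data.Product using (Σ; _×_)
open import Relation.Binary.PropositionalEquality using (_≡_)
open import Relation.Nullary using (¬_)

hamming : ∀ {n} → Vec Bool n → Vec Bool n → ℕ
hamming [] [] = 0
hamming (true ∷ xs) (true ∷ ys) = hamming xs ys
hamming (false ∷ xs) (false ∷ ys) = hamming xs ys
hamming (true ∷ xs) (false ∷ ys) = suc (hamming xs ys)
hamming (false ∷ xs) (true ∷ ys) = suc (hamming xs ys)

V₂ : ℕ → ℕ → ℕ
V₂ n zero = n C 0
V₂ n (suc r) = V₂ n r + n C (suc r)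

data Protocol (X Y : Set) : Set where
  leaf  : Bool → Protocol X Y
  alice : (X → Bool) → Protocol X Y → Protocol X Y → Protocol X Y
  bob   : (Y → Bool) → Protocol X Y → Protocol X Y → Protocol X Y

-- depth = number of bits communicated in the worst case
depth : ∀ {X Y} → Protocol X Y → ℕ
depth (leaf _) = 0
depth (alice _ l r) = suc (depth l ⊔ depth r)
depth (bob _ l r) = suc (depth l ⊔ depth r)

run : ∀ {X Y} → Protocol X Y → X → Y → Bool
run (leaf b) x y = b
run (alice f l r) x y = if f x then run r x y else run l x y
run (bob g l r) x y = if g y then run r x y else run l x y

-- P computes GHD^n_{0,t}: outputs 0 (false) when x = y and 1 (true) when H(x,y) ≥ t;
-- no requirement outside the promise.
ComputesGHD : (n t : ℕ) → Protocol (Vec Bool n) (Vec Bool n) → Set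
ComputesGHD n t P =
  ∀ (x y : Vec Bool n) →
    (x ≡ y → run P x y ≡ false) × (t ≤ hamming x y → run P x y ≡ true)

-- Upper bound: choosing greedily, by averaging, the centre that covers most of the remaining
-- points covers {0,1}^n by about n·2^n / V₂(n,r) balls of radius r = ⌊(t−1)/2⌋. Alice names
-- a ball containing x, Bob says whether y lies in it; as 2r < t this decides GHD, and
-- V₂(n,⌊t/2⌋) ≤ (n+1)·V₂(n,r).
-- Lower bound: a protocol of depth D cuts the input space into 2^D rectangles. No diagonal
-- point (x,x) lies in a 1-rectangle, and the diagonal points of a 0-rectangle form a set of
-- diameter ≤ 2r+1, so 2^n ≤ 2^D·K for any bound K on such sets. A weak form of Kleitman's
-- diameter theorem gives K = 2·V₂(n,r): down-compression turns a bound on distances into a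
-- bound on unions, and Katona's shifting argument bounds families with small pairwise unions.

module Submission where

open import Defs
open import Data.Bool using (Bool; true; false; T; not; _∧_; _∨_; _xor_; if_then_else_)
open import Data.Bool.ListAction using (any)
open import Data.Bool.Properties using (∧-identityʳ; ∨-identityʳ; ∨-assoc; T-∧; T-∨)
open import Data.Empty using (⊥-elim)
open import Data.Fin using (Fin; zero; suc)
open import Data.Fin.Subset using (_∪_; _─_; ∣_∣)
open import Data.List using (List; []; _∷_; length; take; drop; _++_; foldr; allFin)
open import Data.List.Membership.Propositional using (_∈_)
open import Data.List.Membership.Propositional.Properties using (∈-allFin)
open import Data.List.Properties using (length-take; length-drop; take++drop≡id)
open import Data.List.Relation.Unary.Any using (here; there)
open import Data.Nat
open import Data.Nat.Combinatorics using (_C_; nCk+nC[k+1]≡[n+1]C[k+1])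
open import Data.Nat.DivMod using (_/_; m≡m%n+[m/n]*n; m%n<n; m/n*n≤m; m*n/n≡m; /-monoˡ-≤)
open import Data.Nat.Properties
open import Algebra.Properties.CommutativeSemigroup +-commutativeSemigroup
  using () renaming (interchange to +-interchange)
open import Algebra.Properties.CommutativeSemigroup *-commutativeSemigroup
  using (x∙yz≈y∙xz; x∙yz≈xz∙y; xy∙z≈x∙zy; xy∙z≈y∙xz) renaming (interchange to *-interchange)
open import Data.Nat.Tactic.RingSolver using (solve-∀)
open import Data.Product using (Σ; ∃; ∃₂; _×_; _,_; proj₁; proj₂)
open import Data.Sum using (_⊎_; inj₁; inj₂)
open import Data.Unit using (⊤; tt)
open import Data.Vec using (Vec; []; _∷_; replicate)
open import Function using (_∘_; Equivalence)
open Equivalence using (to; from)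
open import Relation.Binary.PropositionalEquality
open import Relation.Nullary using (¬_; yes; no)

-- Sums over the cube

*-double : ∀ a c → a * c + a * c ≡ 2 * a * c
*-double = solve-∀

Family : ℕ → Set
Family n = Vec Bool n → Bool

𝟙 : Bool → ℕ
𝟙 true  = 1
𝟙 false = 0

∑ : ∀ n → (Vec Bool n → ℕ) → ℕ
∑ zero    f = f []
∑ (suc n) f = ∑ n (f ∘ (false ∷_)) + ∑ n (f ∘ (true ∷_))

count : ∀ n → Family n → ℕ
count n F = ∑ n (𝟙 ∘ F)

∑-cong : ∀ n {f g : Vec Bool n → ℕ} → (∀ x → f x ≡ g x) → ∑ n f ≡ ∑ n g
∑-cong zero    f≗g = f≗g []
∑-cong (suc n) f≗g = cong₂ _+_ (∑-cong n (f≗g ∘ (false ∷_))) (∑-cong n (f≗g ∘ (true ∷_)))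

∑-mono-≤ : ∀ n {f g : Vec Bool n → ℕ} → (∀ x → f x ≤ g x) → ∑ n f ≤ ∑ n g
∑-mono-≤ zero    f≤g = f≤g []
∑-mono-≤ (suc n) f≤g = +-mono-≤ (∑-mono-≤ n (f≤g ∘ (false ∷_))) (∑-mono-≤ n (f≤g ∘ (true ∷_)))

∑-distrib-+ : ∀ n (f g : Vec Bool n → ℕ) → ∑ n (λ x → f x + g x) ≡ ∑ n f + ∑ n g
∑-distrib-+ zero    f g = refl
∑-distrib-+ (suc n) f g =
  trans (cong₂ _+_ (∑-distrib-+ n _ _) (∑-distrib-+ n _ _))
        (+-interchange (∑ n (f ∘ (false ∷_))) _ _ _)

∑-distribʳ-* : ∀ n (f : Vec Bool n → ℕ) c → ∑ n (λ x → f x * c) ≡ ∑ n f * c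
∑-distribʳ-* zero    f c = refl
∑-distribʳ-* (suc n) f c =
  trans (cong₂ _+_ (∑-distribʳ-* n _ c) (∑-distribʳ-* n _ c))
        (sym (*-distribʳ-+ c (∑ n (f ∘ (false ∷_))) _))

∑-const : ∀ n c → ∑ n (λ _ → c) ≡ 2 ^ n * c
∑-const zero    c = sym (+-identityʳ c)
∑-const (suc n) c = trans (cong₂ _+_ (∑-const n c) (∑-const n c)) (*-double (2 ^ n) c)

∑-comm : ∀ m n (f : Vec Bool m → Vec Bool n → ℕ) →
         ∑ m (λ x → ∑ n (f x)) ≡ ∑ n (λ y → ∑ m (λ x → f x y))
∑-comm zero    n f = refl
∑-comm (suc m) n f = trans (cong₂ _+_ (∑-comm m n _) (∑-comm m n _)) (sym (∑-distrib-+ n _ _))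

larger-of : ∀ {A : Set} (f : A → ℕ) a b → ∃ λ c → f a ≤ f c × f b ≤ f c
larger-of f a b with f a ≤? f b
... | yes fa≤fb = b , fa≤fb , ≤-refl
... | no  fa≰fb = a , ≤-refl , ≰⇒≥ fa≰fb

∃-above-average : ∀ n (f : Vec Bool n → ℕ) → ∃ λ c → ∑ n f ≤ 2 ^ n * f c
∃-above-average zero    f = [] , ≤-reflexive (sym (+-identityʳ (f [])))
∃-above-average (suc n) f
  with ∃-above-average n (f ∘ (false ∷_)) | ∃-above-average n (f ∘ (true ∷_))
... | c₀ , ∑₀≤ | c₁ , ∑₁≤ with larger-of f (false ∷ c₀) (true ∷ c₁)
...   | c , f₀≤f , f₁≤f = c , (begin
  ∑ n (f ∘ (false ∷_)) + ∑ n (f ∘ (true ∷_))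
    ≤⟨ +-mono-≤ (≤-trans ∑₀≤ (*-monoʳ-≤ (2 ^ n) f₀≤f)) (≤-trans ∑₁≤ (*-monoʳ-≤ (2 ^ n) f₁≤f)) ⟩
  2 ^ n * f c + 2 ^ n * f c
    ≡⟨ *-double (2 ^ n) (f c) ⟩
  2 ^ suc n * f c ∎)
  where open ≤-Reasoning

count≤2^n : ∀ n (F : Family n) → count n F ≤ 2 ^ n
count≤2^n n F = ≤-trans (∑-mono-≤ n (𝟙≤1 ∘ F)) (≤-reflexive (trans (∑-const n 1) (*-identityʳ _)))
  where
  𝟙≤1 : ∀ b → 𝟙 b ≤ 1
  𝟙≤1 true  = ≤-refl
  𝟙≤1 false = z≤n

𝟙-T : ∀ {b} → T b → 1 ≤ 𝟙 b
𝟙-T {true} _ = ≤-refl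

count-empty : ∀ n (F : Family n) → (∀ x → ¬ T (F x)) → count n F ≡ 0
count-empty n F ∉F = trans (∑-cong n (𝟙≡0 ∘ ∉F)) (trans (∑-const n 0) (*-zeroʳ (2 ^ n)))
  where
  𝟙≡0 : ∀ {b} → ¬ T b → 𝟙 b ≡ 0
  𝟙≡0 {false} _  = refl
  𝟙≡0 {true}  ¬T = ⊥-elim (¬T tt)

count>0 : ∀ n (F : Family n) x → T (F x) → 0 < count n F
count>0 zero    F []          Fx with F []
... | true = s≤s z≤n
count>0 (suc n) F (false ∷ x) Fx = ≤-trans (count>0 n _ x Fx) (m≤m+n _ _)
count>0 (suc n) F (true ∷ x)  Fx = ≤-trans (count>0 n _ x Fx) (m≤n+m _ _)

count-split : ∀ n (F G : Family n) →
              count n F ≡ count n (λ x → F x ∧ not (G x)) + count n (λ x → F x ∧ G x)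
count-split n F G = trans (∑-cong n (λ x → 𝟙-split (F x) (G x))) (∑-distrib-+ n _ _)
  where
  𝟙-split : ∀ a b → 𝟙 a ≡ 𝟙 (a ∧ not b) + 𝟙 (a ∧ b)
  𝟙-split true  true  = refl
  𝟙-split true  false = refl
  𝟙-split false b     = refl

count-∨+count-∧ : ∀ n (F G : Family n) →
                  count n (λ x → F x ∨ G x) + count n (λ x → G x ∧ F x) ≡ count n F + count n G
count-∨+count-∧ n F G =
  trans (sym (∑-distrib-+ n _ _)) (trans (∑-cong n (λ x → 𝟙∨+𝟙∧ (F x) (G x))) (∑-distrib-+ n _ _))
  where
  𝟙∨+𝟙∧ : ∀ a b → 𝟙 (a ∨ b) + 𝟙 (b ∧ a) ≡ 𝟙 a + 𝟙 b
  𝟙∨+𝟙∧ true  true  = refl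
  𝟙∨+𝟙∧ true  false = refl
  𝟙∨+𝟙∧ false true  = refl
  𝟙∨+𝟙∧ false false = refl

hamming-∷ : ∀ {n} a b (x y : Vec Bool n) → hamming (a ∷ x) (b ∷ y) ≡ 𝟙 (a xor b) + hamming x y
hamming-∷ true  true  x y = refl
hamming-∷ true  false x y = refl
hamming-∷ false true  x y = refl
hamming-∷ false false x y = refl

hamming-sym : ∀ {n} (x y : Vec Bool n) → hamming x y ≡ hamming y x
hamming-sym []          []          = refl
hamming-sym (true ∷ x)  (true ∷ y)  = hamming-sym x y
hamming-sym (true ∷ x)  (false ∷ y) = cong suc (hamming-sym x y)
hamming-sym (false ∷ x) (true ∷ y)  = cong suc (hamming-sym x y)
hamming-sym (false ∷ x) (false ∷ y) = hamming-sym x y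

hamming-triangle : ∀ {n} (x y z : Vec Bool n) → hamming x z ≤ hamming x y + hamming y z
hamming-triangle []      []      []      = z≤n
hamming-triangle (a ∷ x) (b ∷ y) (c ∷ z) = begin
  hamming (a ∷ x) (c ∷ z)
    ≡⟨ hamming-∷ a c x z ⟩
  𝟙 (a xor c) + hamming x z
    ≤⟨ +-mono-≤ (xor-triangle a b c) (hamming-triangle x y z) ⟩
  (𝟙 (a xor b) + 𝟙 (b xor c)) + (hamming x y + hamming y z)
    ≡⟨ +-interchange (𝟙 (a xor b)) _ _ _ ⟩
  (𝟙 (a xor b) + hamming x y) + (𝟙 (b xor c) + hamming y z)
    ≡⟨ sym (cong₂ _+_ (hamming-∷ a b x y) (hamming-∷ b c y z)) ⟩
  hamming (a ∷ x) (b ∷ y) + hamming (b ∷ y) (c ∷ z) ∎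
  where
  open ≤-Reasoning
  xor-triangle : ∀ a b c → 𝟙 (a xor c) ≤ 𝟙 (a xor b) + 𝟙 (b xor c)
  xor-triangle true  true  true  = z≤n
  xor-triangle true  true  false = ≤-refl
  xor-triangle true  false true  = z≤n
  xor-triangle true  false false = ≤-refl
  xor-triangle false true  true  = ≤-refl
  xor-triangle false true  false = z≤n
  xor-triangle false false true  = ≤-refl
  xor-triangle false false false = z≤n

hamming-antipodal : ∀ n (y : Vec Bool n) →
                    hamming (replicate n false) y + hamming (replicate n true) y ≡ n
hamming-antipodal zero    []          = refl
hamming-antipodal (suc n) (true ∷ y)  = cong suc (hamming-antipodal n y)
hamming-antipodal (suc n) (false ∷ y) = trans (+-suc _ _) (cong suc (hamming-antipodal n y))

-- Hamming balls

V₂-pascal : ∀ n r → V₂ (suc n) (suc r) ≡ V₂ n (suc r) + V₂ n r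
V₂-pascal n zero = begin
  1 + suc n C 1        ≡⟨ cong (1 +_) (sym (nCk+nC[k+1]≡[n+1]C[k+1] n 0)) ⟩
  1 + (1 + n C 1)      ≡⟨ +-comm 1 (1 + n C 1) ⟩
  (1 + n C 1) + 1      ∎
  where open ≡-Reasoning
V₂-pascal n (suc r) = begin
  V₂ (suc n) (suc r) + suc n C suc (suc r)
    ≡⟨ cong₂ _+_ (V₂-pascal n r) (sym (nCk+nC[k+1]≡[n+1]C[k+1] n (suc r))) ⟩
  (V₂ n (suc r) + V₂ n r) + (n C suc r + n C suc (suc r))
    ≡⟨ regroup (V₂ n (suc r)) (V₂ n r) (n C suc r) (n C suc (suc r)) ⟩
  (V₂ n (suc r) + n C suc (suc r)) + (V₂ n r + n C suc r) ∎
  where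
  open ≡-Reasoning
  regroup : ∀ a b c d → (a + b) + (c + d) ≡ (a + d) + (b + c)
  regroup = solve-∀

V₂-dim0 : ∀ r → V₂ 0 r ≡ 1
V₂-dim0 zero    = refl
V₂-dim0 (suc r) = trans (+-identityʳ (V₂ 0 r)) (V₂-dim0 r)

V₂-mono-≤ : ∀ n {r s} → r ≤ s → V₂ n r ≤ V₂ n s
V₂-mono-≤ n {r} {zero}  z≤n = ≤-refl
V₂-mono-≤ n {r} {suc s} r≤1+s with m≤n⇒m<n∨m≡n r≤1+s
... | inj₁ r<1+s = ≤-trans (V₂-mono-≤ n (≤-pred r<1+s)) (m≤m+n (V₂ n s) _)
... | inj₂ refl  = ≤-refl

V₂-suc-dim : ∀ n r → V₂ n r ≤ V₂ (suc n) r
V₂-suc-dim n zero    = ≤-refl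
V₂-suc-dim n (suc r) = ≤-trans (m≤m+n _ _) (≤-reflexive (sym (V₂-pascal n r)))

V₂-suc-radius : ∀ n r → V₂ n (suc r) ≤ suc n * V₂ n r
V₂-suc-radius zero    r = ≤-reflexive (trans (V₂-dim0 (suc r)) (sym (cong (_+ 0) (V₂-dim0 r))))
V₂-suc-radius (suc n) r = begin
  V₂ (suc n) (suc r)             ≡⟨ V₂-pascal n r ⟩
  V₂ n (suc r) + V₂ n r          ≤⟨ +-monoˡ-≤ (V₂ n r) (V₂-suc-radius n r) ⟩
  suc n * V₂ n r + V₂ n r        ≡⟨ +-comm (suc n * V₂ n r) (V₂ n r) ⟩
  suc (suc n) * V₂ n r           ≤⟨ *-monoʳ-≤ (suc (suc n)) (V₂-suc-dim n r) ⟩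
  suc (suc n) * V₂ (suc n) r     ∎
  where open ≤-Reasoning

-- Stated with _<ᵇ_ so that ball (b ∷ c) r (b′ ∷ y) reduces to hamming c y <ᵇ suc r or hamming c y <ᵇ r.
ball : ∀ {n} → Vec Bool n → ℕ → Family n
ball c r y = hamming c y <ᵇ suc r

ball-sym : ∀ {n} (c y : Vec Bool n) r → ball c r y ≡ ball y r c
ball-sym c y r = cong (_<ᵇ suc r) (hamming-sym c y)

ball⇒≤ : ∀ {n} (c y : Vec Bool n) r → T (ball c r y) → hamming c y ≤ r
ball⇒≤ c y r y∈B = ≤-pred (<ᵇ⇒< (hamming c y) (suc r) y∈B)

count-ball : ∀ n (c : Vec Bool n) r → count n (ball c r) ≡ V₂ n r
count-ball zero    []      r = sym (V₂-dim0 r)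
count-ball (suc n) (b ∷ c) r = trans (split b) (by-radius r)
  where
  split : ∀ b → count (suc n) (ball (b ∷ c) r)
                ≡ count n (ball c r) + count n (λ y → hamming c y <ᵇ r)
  split false = refl
  split true  = +-comm _ (count n (ball c r))
  by-radius : ∀ r → count n (ball c r) + count n (λ y → hamming c y <ᵇ r) ≡ V₂ (suc n) r
  by-radius zero    = cong₂ _+_ (count-ball n c 0) (count-empty n _ (λ _ ()))
  by-radius (suc r) = trans (cong₂ _+_ (count-ball n c (suc r)) (count-ball n c r)) (sym (V₂-pascal n r))

V₂≤2^n : ∀ n r → V₂ n r ≤ 2 ^ n
V₂≤2^n n r = ≤-trans (≤-reflexive (sym (count-ball n (replicate n false) r))) (count≤2^n n _)

-- The balls of radius r around 0…0 and 1…1 cover the cube.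
2^n≤2*V₂ : ∀ n r → n ≤ suc (r + r) → 2 ^ n ≤ 2 * V₂ n r
2^n≤2*V₂ n r n≤2r+1 = begin
  2 ^ n                                    ≡⟨ sym (trans (∑-const n 1) (*-identityʳ _)) ⟩
  ∑ n (λ _ → 1)                            ≤⟨ ∑-mono-≤ n in-some-ball ⟩
  ∑ n (λ y → 𝟙 (ball o r y) + 𝟙 (ball i r y)) ≡⟨ ∑-distrib-+ n _ _ ⟩
  count n (ball o r) + count n (ball i r)  ≡⟨ cong₂ _+_ (count-ball n o r) (count-ball n i r) ⟩
  V₂ n r + V₂ n r                          ≡⟨ cong (V₂ n r +_) (sym (+-identityʳ (V₂ n r))) ⟩
  2 * V₂ n r                               ∎
  where
  open ≤-Reasoning
  o = replicate n false
  i = replicate n true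
  in-some-ball : ∀ y → 1 ≤ 𝟙 (ball o r y) + 𝟙 (ball i r y)
  in-some-ball y with hamming o y ≤? r
  ... | yes o≤r = ≤-trans (𝟙-T (<⇒<ᵇ (s≤s o≤r))) (m≤m+n _ _)
  ... | no  o≰r = ≤-trans (𝟙-T (<⇒<ᵇ (s≤s (+-cancelˡ-≤ (suc r) _ _ (begin
    suc r + hamming i y           ≤⟨ +-monoˡ-≤ (hamming i y) (≰⇒> o≰r) ⟩
    hamming o y + hamming i y     ≡⟨ hamming-antipodal n y ⟩
    n                             ≤⟨ n≤2r+1 ⟩
    suc r + r                     ∎))))) (m≤n+m _ _)

-- Greedy covering and the upper bound

covered : ∀ {n} → ℕ → List (Vec Bool n) → Family n
covered r L x = any (λ c → ball c r x) L

uncovered : ∀ {n} → ℕ → List (Vec Bool n) → Family n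
uncovered r L = not ∘ covered r L

best-centre : ∀ n r (U : Family n) →
              ∃ λ c → count n U * V₂ n r ≤ 2 ^ n * count n (λ y → U y ∧ ball c r y)
best-centre n r U with ∃-above-average n (λ c → count n (λ y → U y ∧ ball c r y))
... | c , ∑≤ = c , (begin
  count n U * V₂ n r
    ≡⟨ sym (∑-distribʳ-* n _ _) ⟩
  ∑ n (λ y → 𝟙 (U y) * V₂ n r)
    ≡⟨ ∑-cong n (λ y → trans (*-comm _ (V₂ n r)) (cong (_* 𝟙 (U y)) (sym (count-ball n y r)))) ⟩
  ∑ n (λ y → count n (ball y r) * 𝟙 (U y))
    ≡⟨ ∑-cong n (λ y → sym (∑-distribʳ-* n _ _)) ⟩
  ∑ n (λ y → ∑ n (λ c → 𝟙 (ball y r c) * 𝟙 (U y)))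
    ≡⟨ ∑-cong n (λ y → ∑-cong n (λ c → trans (cong (λ b → 𝟙 b * 𝟙 (U y)) (ball-sym y c r))
                                              (𝟙-∧ (U y) (ball c r y)))) ⟩
  ∑ n (λ y → ∑ n (λ c → 𝟙 (U y ∧ ball c r y)))
    ≡⟨ ∑-comm n n _ ⟩
  ∑ n (λ c → count n (λ y → U y ∧ ball c r y))
    ≤⟨ ∑≤ ⟩
  2 ^ n * count n (λ y → U y ∧ ball c r y) ∎)
  where
  open ≤-Reasoning
  𝟙-∧ : ∀ a b → 𝟙 b * 𝟙 a ≡ 𝟙 (a ∧ b)
  𝟙-∧ true  true  = refl
  𝟙-∧ true  false = refl
  𝟙-∧ false true  = refl
  𝟙-∧ false false = refl

greedy-cover : ∀ n r k → ∃ λ (L : List (Vec Bool n)) → length L ≡ k ×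
               (2 ^ n) ^ k * count n (uncovered r L) ≤ (2 ^ n ∸ V₂ n r) ^ k * 2 ^ n
greedy-cover n r zero = [] , refl , ≤-trans (≤-reflexive (+-identityʳ _))
                                            (≤-trans (count≤2^n n _) (≤-reflexive (sym (+-identityʳ _))))
greedy-cover n r (suc k) with greedy-cover n r k
... | L , ∣L∣≡k , invariant with best-centre n r (uncovered r L)
... | c , c-good = c ∷ L , cong suc ∣L∣≡k , (begin
  M * M ^ k * u′      ≡⟨ *-assoc M (M ^ k) u′ ⟩
  M * (M ^ k * u′)    ≡⟨ x∙yz≈y∙xz M (M ^ k) u′ ⟩
  M ^ k * (M * u′)    ≤⟨ *-monoʳ-≤ (M ^ k) one-step ⟩
  M ^ k * (D * u)     ≡⟨ x∙yz≈y∙xz (M ^ k) D u ⟩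
  D * (M ^ k * u)     ≤⟨ *-monoʳ-≤ D invariant ⟩
  D * (D ^ k * M)     ≡⟨ sym (*-assoc D (D ^ k) M) ⟩
  D * D ^ k * M       ∎)
  where
  open ≤-Reasoning
  M = 2 ^ n
  V = V₂ n r
  D = M ∸ V
  U = uncovered r L
  u = count n U
  u′ = count n (uncovered r (c ∷ L))
  hit = count n (λ y → U y ∧ ball c r y)
  u≡u′+hit : u ≡ u′ + hit
  u≡u′+hit = trans (count-split n U (ball c r))
                    (cong (_+ hit) (∑-cong n (λ y → cong 𝟙 (not-∨ (ball c r y) (covered r L y)))))
    where
    not-∨ : ∀ a b → not b ∧ not a ≡ not (a ∨ b)
    not-∨ true  true  = refl
    not-∨ true  false = refl
    not-∨ false b     = ∧-identityʳ (not b)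
  one-step : M * u′ ≤ D * u
  one-step = begin
    M * u′                    ≡⟨ sym (m+n∸n≡m (M * u′) (M * hit)) ⟩
    M * u′ + M * hit ∸ M * hit ≡⟨ cong (_∸ M * hit) (sym (trans (cong (M *_) u≡u′+hit) (*-distribˡ-+ M u′ hit))) ⟩
    M * u ∸ M * hit           ≤⟨ ∸-monoʳ-≤ (M * u) (≤-trans (≤-reflexive (*-comm V u)) c-good) ⟩
    M * u ∸ V * u             ≡⟨ sym (*-distribʳ-∸ u M V) ⟩
    D * u                     ∎

^-distribʳ-* : ∀ a b k → (a * b) ^ k ≡ a ^ k * b ^ k
^-distribʳ-* a b zero    = refl
^-distribʳ-* a b (suc k) = trans (cong (a * b *_) (^-distribʳ-* a b k)) (*-interchange a b (a ^ k) (b ^ k))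

bernoulli : ∀ M V m → M ^ m * (M + m * V) ≤ M * (M + V) ^ m
bernoulli M V zero    = ≤-reflexive (trans (+-identityʳ _) (trans (+-identityʳ M) (sym (*-identityʳ M))))
bernoulli M V (suc m) = begin
  M * M ^ m * (M + (V + m * V))
    ≡⟨ expand M V (M ^ m) (m * V) ⟩
  M ^ m * (M + m * V) * M + M ^ m * M * V
    ≤⟨ +-monoʳ-≤ (M ^ m * (M + m * V) * M) (*-monoˡ-≤ V (*-monoʳ-≤ (M ^ m) (m≤m+n M (m * V)))) ⟩
  M ^ m * (M + m * V) * M + M ^ m * (M + m * V) * V
    ≡⟨ sym (*-distribˡ-+ (M ^ m * (M + m * V)) M V) ⟩
  M ^ m * (M + m * V) * (M + V)
    ≤⟨ *-monoˡ-≤ (M + V) (bernoulli M V m) ⟩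
  M * (M + V) ^ m * (M + V)
    ≡⟨ xy∙z≈x∙zy M ((M + V) ^ m) (M + V) ⟩
  M * ((M + V) * (M + V) ^ m) ∎
  where
  open ≤-Reasoning
  expand : ∀ M V p q → M * p * (M + (V + q)) ≡ p * (M + q) * M + p * M * V
  expand = solve-∀

[m+n]*[m∸n]≤m*m : ∀ M V → (M + V) * (M ∸ V) ≤ M * M
[m+n]*[m∸n]≤m*m M V with V ≤? M
... | no  V≰M rewrite m≤n⇒m∸n≡0 (<⇒≤ (≰⇒> V≰M)) | *-zeroʳ (M + V) = z≤n
... | yes V≤M = begin
  (M + V) * (M ∸ V)      ≡⟨ cong (λ z → (z + V) * a) (sym a+V≡M) ⟩
  (a + V + V) * a        ≤⟨ m≤m+n _ (V * V) ⟩
  (a + V + V) * a + V * V ≡⟨ square a V ⟩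
  (a + V) * (a + V)      ≡⟨ cong₂ _*_ a+V≡M a+V≡M ⟩
  M * M                  ∎
  where
  open ≤-Reasoning
  a = M ∸ V
  a+V≡M : a + V ≡ M
  a+V≡M = m∸n+n≡m V≤M
  square : ∀ a V → (a + V + V) * a + V * V ≡ (a + V) * (a + V)
  square = solve-∀

-- (1 − V/M)^m ≤ 1/2 when mV ≥ M: by Bernoulli (1 + V/M)^m ≥ 1 + mV/M ≥ 2, and (1 − V/M)(1 + V/M) ≤ 1.
halving : ∀ M V m .{{_ : NonZero M}} → M ≤ m * V → 2 * (M ∸ V) ^ m ≤ M ^ m
halving M V m M≤mV = *-cancelˡ-≤ (M ^ m) {{m^n≢0 M m}} (begin
  M ^ m * (2 * (M ∸ V) ^ m)         ≡⟨ x∙yz≈y∙xz (M ^ m) 2 _ ⟩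
  2 * (M ^ m * (M ∸ V) ^ m)         ≡⟨ sym (*-assoc 2 (M ^ m) _) ⟩
  2 * M ^ m * (M ∸ V) ^ m           ≤⟨ *-monoˡ-≤ ((M ∸ V) ^ m) 2M^m≤[M+V]^m ⟩
  (M + V) ^ m * (M ∸ V) ^ m         ≡⟨ sym (^-distribʳ-* (M + V) (M ∸ V) m) ⟩
  ((M + V) * (M ∸ V)) ^ m           ≤⟨ ^-monoˡ-≤ m ([m+n]*[m∸n]≤m*m M V) ⟩
  (M * M) ^ m                       ≡⟨ ^-distribʳ-* M M m ⟩
  M ^ m * M ^ m                     ∎)
  where
  open ≤-Reasoning
  2M^m≤[M+V]^m : 2 * M ^ m ≤ (M + V) ^ m
  2M^m≤[M+V]^m = *-cancelˡ-≤ M (begin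
    M * (2 * M ^ m)          ≡⟨ rearrange M (M ^ m) ⟩
    M ^ m * (M + M)          ≤⟨ *-monoʳ-≤ (M ^ m) (+-monoʳ-≤ M M≤mV) ⟩
    M ^ m * (M + m * V)      ≤⟨ bernoulli M V m ⟩
    M * (M + V) ^ m          ∎)
    where
    rearrange : ∀ a b → a * (2 * b) ≡ b * (a + a)
    rearrange = solve-∀

∃-multiple-between : ∀ M V .{{_ : NonZero V}} → ∃ λ m → M ≤ m * V × m * V ≤ V + M
∃-multiple-between M V = suc (M / V) , M≤ , +-monoʳ-≤ V (m/n*n≤m M V)
  where
  M≤ : M ≤ V + M / V * V
  M≤ = ≤-trans (≤-reflexive (m≡m%n+[m/n]*n M V)) (+-monoˡ-≤ (M / V * V) (<⇒≤ (m%n<n M V)))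

a*u≤b∧2b≤a⇒u≡0 : ∀ a b u → 0 < a → a * u ≤ b → 2 * b ≤ a → u ≡ 0
a*u≤b∧2b≤a⇒u≡0 a b zero    0<a au≤b 2b≤a = refl
a*u≤b∧2b≤a⇒u≡0 a b (suc u) 0<a au≤b 2b≤a = ⊥-elim (<⇒≱ a<2a (≤-trans (*-monoʳ-≤ 2 a≤b) 2b≤a))
  where
  a<2a : a < 2 * a
  a<2a = ≤-trans (m<m+n a 0<a) (≤-reflexive (cong (a +_) (sym (+-identityʳ a))))
  a≤b : a ≤ b
  a≤b = ≤-trans (m≤m*n a (suc u)) au≤b

V₂-nonZero : ∀ n r → NonZero (V₂ n r)
V₂-nonZero n r = >-nonZero (V₂-mono-≤ n {0} {r} z≤n)

-- m·(n+1) greedy steps, with mV ≈ 2^n, leave less than one uncovered point.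
∃-covering : ∀ n r → ∃ λ (L : List (Vec Bool n)) →
             (∀ x → T (covered r L x)) × length L * V₂ n r ≤ suc n * (2 ^ n + 2 ^ n)
∃-covering n r with ∃-multiple-between (2 ^ n) (V₂ n r) {{V₂-nonZero n r}}
... | m , M≤mV , mV≤V+M with greedy-cover n r (m * suc n)
... | L , ∣L∣≡k , invariant = L , covers-all , size
  where
  M = 2 ^ n
  V = V₂ n r
  D = M ∸ V
  k = m * suc n
  2D^kM≤M^k : 2 * (D ^ k * M) ≤ M ^ k
  2D^kM≤M^k = begin
    2 * (D ^ k * M)               ≡⟨ cong (λ z → 2 * (z * M)) (sym (^-*-assoc D m (suc n))) ⟩
    2 * ((D ^ m) ^ suc n * M)     ≡⟨ x∙yz≈xz∙y 2 _ M ⟩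
    2 ^ suc n * (D ^ m) ^ suc n   ≡⟨ sym (^-distribʳ-* 2 (D ^ m) (suc n)) ⟩
    (2 * D ^ m) ^ suc n           ≤⟨ ^-monoˡ-≤ (suc n) (halving M V m {{m^n≢0 2 n}} M≤mV) ⟩
    (M ^ m) ^ suc n               ≡⟨ ^-*-assoc M m (suc n) ⟩
    M ^ k                         ∎
    where open ≤-Reasoning
  nothing-uncovered : count n (uncovered r L) ≡ 0
  nothing-uncovered = a*u≤b∧2b≤a⇒u≡0 (M ^ k) (D ^ k * M) _ (m^n>0 M {{m^n≢0 2 n}} k) invariant 2D^kM≤M^k
  covers-all : ∀ x → T (covered r L x)
  covers-all x with covered r L x in eq
  ... | true  = tt
  ... | false = ⊥-elim (<⇒≢ (count>0 n (uncovered r L) x (subst (T ∘ not) (sym eq) tt)) (sym nothing-uncovered))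
  size : length L * V ≤ suc n * (M + M)
  size = begin
    length L * V       ≡⟨ cong (_* V) ∣L∣≡k ⟩
    m * suc n * V      ≡⟨ xy∙z≈y∙xz m (suc n) V ⟩
    suc n * (m * V)    ≤⟨ *-monoʳ-≤ (suc n) (≤-trans mV≤V+M (+-monoˡ-≤ M (V₂≤2^n n r))) ⟩
    suc n * (M + M)    ∎
    where open ≤-Reasoning

ValidOutput : ∀ {n} → ℕ → Vec Bool n → Vec Bool n → Bool → Set
ValidOutput t x y b = (x ≡ y → b ≡ false) × (t ≤ hamming x y → b ≡ true)

if-T : ∀ {A : Set} {b} {u v : A} → T b → (if b then u else v) ≡ u
if-T {b = true} _ = refl

if-T-not : ∀ {A : Set} {b} {u v : A} → T (not b) → (if b then u else v) ≡ v
if-T-not {b = false} _ = refl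

length-drop-≤ : ∀ {A : Set} m (L : List A) → length L ≤ 2 * m → length (drop m L) ≤ m
length-drop-≤ m L ∣L∣≤2m = begin
  length (drop m L)       ≡⟨ length-drop m L ⟩
  length L ∸ m            ≤⟨ ∸-monoˡ-≤ m ∣L∣≤2m ⟩
  m + (m + 0) ∸ m         ≡⟨ m+n∸m≡n m (m + 0) ⟩
  m + 0                   ≡⟨ +-identityʳ m ⟩
  m                       ∎
  where open ≤-Reasoning

module _ {n : ℕ} (r : ℕ) where

  covered-++ : ∀ (L L′ : List (Vec Bool n)) x → covered r (L ++ L′) x ≡ covered r L x ∨ covered r L′ x
  covered-++ []      L′ x = refl
  covered-++ (c ∷ L) L′ x = trans (cong (ball c r x ∨_) (covered-++ L L′ x)) (sym (∨-assoc (ball c r x) _ _))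

  covered-drop : ∀ m L x → covered r (take m L) x ≡ false → covered r L x ≡ covered r (drop m L) x
  covered-drop m L x not-in-take = begin
    covered r L x                                        ≡⟨ cong (λ L′ → covered r L′ x) (sym (take++drop≡id m L)) ⟩
    covered r (take m L ++ drop m L) x                   ≡⟨ covered-++ (take m L) (drop m L) x ⟩
    covered r (take m L) x ∨ covered r (drop m L) x      ≡⟨ cong (_∨ covered r (drop m L) x) not-in-take ⟩
    covered r (drop m L) x                               ∎
    where open ≡-Reasoning

  -- Alice locates a ball containing x by binary search on the list of centres; Bob says whether y is in it.
  cover-protocol : ℕ → List (Vec Bool n) → Protocol (Vec Bool n) (Vec Bool n)
  cover-protocol zero    []      = leaf true
  cover-protocol zero    (c ∷ _) = bob (ball c r) (leaf true) (leaf false)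
  cover-protocol (suc d) L       =
    alice (covered r (take (2 ^ d) L)) (cover-protocol d (drop (2 ^ d) L)) (cover-protocol d (take (2 ^ d) L))

  cover-protocol-depth : ∀ d L → depth (cover-protocol d L) ≤ suc d
  cover-protocol-depth zero    []      = z≤n
  cover-protocol-depth zero    (c ∷ L) = ≤-refl
  cover-protocol-depth (suc d) L       = s≤s (⊔-lub (cover-protocol-depth d _) (cover-protocol-depth d _))

  cover-protocol-correct : ∀ t → r + r < t → ∀ d L x y → length L ≤ 2 ^ d → T (covered r L x) →
                           ValidOutput t x y (run (cover-protocol d L) x y)
  cover-protocol-correct t 2r<t zero (c ∷ []) x y _ x∈L = (λ { refl → if-T x∈B }) , far
    where
    x∈B : T (ball c r x)
    x∈B = subst T (∨-identityʳ (ball c r x)) x∈L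
    far : t ≤ hamming x y → (if ball c r y then false else true) ≡ true
    far t≤H with ball c r y in y∈B
    ... | false = refl
    ... | true  = ⊥-elim (<⇒≱ (≤-<-trans 2r≥H 2r<t) t≤H)
      where
      2r≥H : hamming x y ≤ r + r
      2r≥H = begin
        hamming x y                ≤⟨ hamming-triangle x c y ⟩
        hamming x c + hamming c y  ≡⟨ cong (_+ hamming c y) (hamming-sym x c) ⟩
        hamming c x + hamming c y  ≤⟨ +-mono-≤ (ball⇒≤ c x r x∈B) (ball⇒≤ c y r (subst T (sym y∈B) tt)) ⟩
        r + r                      ∎
        where open ≤-Reasoning
  cover-protocol-correct t 2r<t zero (c ∷ _ ∷ _) x y (s≤s ()) _
  cover-protocol-correct t 2r<t (suc d) L x y ∣L∣≤ x∈L with covered r (take (2 ^ d) L) x in eq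
  ... | true  = cover-protocol-correct t 2r<t d (take (2 ^ d) L) x y ∣take∣≤ (subst T (sym eq) tt)
    where
    ∣take∣≤ : length (take (2 ^ d) L) ≤ 2 ^ d
    ∣take∣≤ = ≤-trans (≤-reflexive (length-take (2 ^ d) L)) (m⊓n≤m _ _)
  ... | false = cover-protocol-correct t 2r<t d (drop (2 ^ d) L) x y
                  (length-drop-≤ (2 ^ d) L ∣L∣≤) (subst T (covered-drop (2 ^ d) L x eq) x∈L)

∃-power-of-2-between : ∀ k → ∃ λ d → k ≤ 2 ^ d × 2 ^ d ≤ suc (2 * k)
∃-power-of-2-between zero = 0 , z≤n , ≤-refl
∃-power-of-2-between (suc k) with ∃-power-of-2-between k
... | d , k≤2^d , 2^d≤1+2k with suc k ≤? 2 ^ d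
...   | yes 1+k≤2^d = d , 1+k≤2^d , ≤-trans 2^d≤1+2k (s≤s (*-monoʳ-≤ 2 (n≤1+n k)))
...   | no  1+k≰2^d = suc d , ≤-trans (≤-reflexive (cong suc k≡2^d)) 1+2^d≤2*2^d
                            , ≤-trans (≤-reflexive (cong (2 *_) (sym k≡2^d)))
                                      (≤-trans (*-monoʳ-≤ 2 (n≤1+n k)) (n≤1+n _))
  where
  k≡2^d : k ≡ 2 ^ d
  k≡2^d = ≤-antisym k≤2^d (≤-pred (≰⇒> 1+k≰2^d))
  1+2^d≤2*2^d : suc (2 ^ d) ≤ 2 * 2 ^ d
  1+2^d≤2*2^d = ≤-trans (+-monoˡ-≤ (2 ^ d) (m^n>0 2 d)) (≤-reflexive (cong (2 ^ d +_) (sym (+-identityʳ _))))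

half-bounds : ∀ m → m / 2 + m / 2 ≤ m × m ≤ suc (m / 2 + m / 2)
half-bounds m = ≤-trans (≤-reflexive (sym (*2≡+ (m / 2)))) (m/n*n≤m m 2)
              , ≤-trans (≤-reflexive (m≡m%n+[m/n]*n m 2))
                        (+-mono-≤ (≤-pred (m%n<n m 2)) (≤-reflexive (*2≡+ (m / 2))))
  where
  *2≡+ : ∀ a → a * 2 ≡ a + a
  *2≡+ = solve-∀

suc-/2≤ : ∀ m → suc m / 2 ≤ suc (m / 2)
suc-/2≤ m = ≤-trans (/-monoˡ-≤ 2 (≤-trans (s≤s (proj₂ (half-bounds m))) (≤-reflexive (+2≡*2 (m / 2)))))
                    (≤-reflexive (m*n/n≡m (suc (m / 2)) 2))
  where
  +2≡*2 : ∀ a → suc (suc (a + a)) ≡ suc a * 2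
  +2≡*2 = solve-∀

cover-cost : ∀ n M k V → 1 ≤ n → k * V ≤ suc n * (M + M) → V ≤ M →
             2 * suc (2 * k) * (suc n * V) ≤ M * (2 * n) ^ 6
cover-cost n M k V 1≤n kV≤ V≤M = begin
  2 * suc (2 * k) * (suc n * V)
    ≡⟨ expand k V (suc n) ⟩
  2 * suc n * (2 * (k * V) + V)
    ≤⟨ *-mono-≤ (*-monoʳ-≤ 2 1+n≤X) (+-mono-≤ (*-monoʳ-≤ 2 (≤-trans kV≤ (*-monoˡ-≤ (M + M) 1+n≤X)))
                                             (≤-trans V≤M (m≤n*m M X {{X≢0}}))) ⟩
  2 * X * (2 * (X * (M + M)) + X * M)
    ≡⟨ collect X M ⟩
  10 * (X * X * M)
    ≤⟨ *-monoˡ-≤ (X * X * M) (≤-trans (m≤m+n 10 6) (^-monoˡ-≤ 4 2≤X)) ⟩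
  X ^ 4 * (X * X * M)
    ≡⟨ finish X M ⟩
  M * X ^ 6 ∎
  where
  open ≤-Reasoning
  X = 2 * n
  2≤X : 2 ≤ X
  2≤X = *-monoʳ-≤ 2 1≤n
  X≢0 : NonZero X
  X≢0 = >-nonZero (≤-trans (s≤s z≤n) 2≤X)
  1+n≤X : suc n ≤ X
  1+n≤X = ≤-trans (+-monoˡ-≤ n 1≤n) (≤-reflexive (cong (n +_) (sym (+-identityʳ n))))
  expand : ∀ k V s → 2 * suc (2 * k) * (s * V) ≡ 2 * s * (2 * (k * V) + V)
  expand = solve-∀
  collect : ∀ X M → 2 * X * (2 * (X * (M + M)) + X * M) ≡ 10 * (X * X * M)
  collect = solve-∀
  finish : ∀ X M → X * (X * (X * (X * 1))) * (X * X * M) ≡ M * (X * (X * (X * (X * (X * (X * 1))))))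
  finish = solve-∀

upper-bound : ∀ n t → 1 ≤ n → 1 ≤ t →
  Σ (Protocol (Vec Bool n) (Vec Bool n)) λ P → ComputesGHD n t P ×
    (2 ^ depth P * V₂ n (t / 2) ≤ 2 ^ n * (2 * n) ^ 6)
upper-bound n (suc t′) 1≤n _ with ∃-covering n (t′ / 2)
... | L , covers-all , ∣L∣V≤ with ∃-power-of-2-between (length L)
... | d , ∣L∣≤2^d , 2^d≤ = P , correct , cost
  where
  ρ = t′ / 2
  P = cover-protocol ρ d L
  correct : ComputesGHD n (suc t′) P
  correct x y = cover-protocol-correct ρ (suc t′) (s≤s (proj₁ (half-bounds t′))) d L x y ∣L∣≤2^d (covers-all x)
  cost : 2 ^ depth P * V₂ n (suc t′ / 2) ≤ 2 ^ n * (2 * n) ^ 6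
  cost = begin
    2 ^ depth P * V₂ n (suc t′ / 2)
      ≤⟨ *-mono-≤ (^-monoʳ-≤ 2 (cover-protocol-depth ρ d L)) (V₂-mono-≤ n (suc-/2≤ t′)) ⟩
    2 * 2 ^ d * V₂ n (suc ρ)
      ≤⟨ *-mono-≤ (*-monoʳ-≤ 2 2^d≤) (V₂-suc-radius n ρ) ⟩
    2 * suc (2 * length L) * (suc n * V₂ n ρ)
      ≤⟨ cover-cost n (2 ^ n) (length L) (V₂ n ρ) 1≤n ∣L∣V≤ (V₂≤2^n n ρ) ⟩
    2 ^ n * (2 * n) ^ 6 ∎
    where open ≤-Reasoning

-- The rectangle bound

DiameterAtMost : ∀ {n} → ℕ → Family n → Set
DiameterAtMost d S = ∀ x y → T (S x) → T (S y) → hamming x y ≤ d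

2^a*K+2^b*K≤2^[1+a⊔b]*K : ∀ a b K → 2 ^ a * K + 2 ^ b * K ≤ 2 ^ suc (a ⊔ b) * K
2^a*K+2^b*K≤2^[1+a⊔b]*K a b K = ≤-trans
  (+-mono-≤ (*-monoˡ-≤ K (^-monoʳ-≤ 2 (m≤m⊔n a b))) (*-monoˡ-≤ K (^-monoʳ-≤ 2 (m≤n⊔m a b))))
  (≤-reflexive (*-double (2 ^ (a ⊔ b)) K))

module _ {n : ℕ} (d K : ℕ) (bounded : ∀ (S : Family n) → DiameterAtMost d S → count n S ≤ K) where

  private
    split-count : ∀ (S : Family n) g {a b} →
                  count n (λ x → S x ∧ not (g x)) ≤ 2 ^ a * K → count n (λ x → S x ∧ g x) ≤ 2 ^ b * K →
                  count n S ≤ 2 ^ suc (a ⊔ b) * K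
    split-count S g {a} {b} ≤₀ ≤₁ =
      ≤-trans (≤-reflexive (count-split n S g)) (≤-trans (+-mono-≤ ≤₀ ≤₁) (2^a*K+2^b*K≤2^[1+a⊔b]*K a b K))

  -- A 1-leaf reaches no diagonal point (x,x) of A × B, and the diagonal points reaching a 0-leaf
  -- are pairwise at distance ≤ d.
  diagonal-count : ∀ (P : Protocol (Vec Bool n) (Vec Bool n)) (A B : Vec Bool n → Set) (S : Family n) →
                   (∀ x y → A x → B y → ValidOutput (suc d) x y (run P x y)) → (∀ x → T (S x) → A x × B x) →
                   count n S ≤ 2 ^ depth P * K
  diagonal-count (leaf true) A B S correct S⊆ = ≤-trans (≤-reflexive (count-empty n S off-diagonal)) z≤n
    where
    off-diagonal : ∀ x → ¬ T (S x)
    off-diagonal x x∈S with () ← proj₁ (correct x x (proj₁ (S⊆ x x∈S)) (proj₂ (S⊆ x x∈S))) refl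
  diagonal-count (leaf false) A B S correct S⊆ = ≤-trans (bounded S close) (≤-reflexive (sym (+-identityʳ K)))
    where
    close : DiameterAtMost d S
    close x y x∈S y∈S with suc d ≤? hamming x y
    ... | no  d≱ = ≤-pred (≰⇒> d≱)
    ... | yes d< with () ← proj₂ (correct x y (proj₁ (S⊆ x x∈S)) (proj₂ (S⊆ y y∈S))) d<
  diagonal-count (alice f l r) A B S correct S⊆ = split-count S f {depth l} {depth r}
    (diagonal-count l (λ x → A x × T (not (f x))) B (λ x → S x ∧ not (f x))
      (λ x y (Ax , ¬fx) By → subst (ValidOutput (suc d) x y) (if-T-not ¬fx) (correct x y Ax By)) (restrict (not ∘ f)))
    (diagonal-count r (λ x → A x × T (f x)) B (λ x → S x ∧ f x)
      (λ x y (Ax , fx) By → subst (ValidOutput (suc d) x y) (if-T fx) (correct x y Ax By)) (restrict f))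
    where
    restrict : ∀ h x → T (S x ∧ h x) → (A x × T (h x)) × B x
    restrict h x x∈S∧h with x∈S , hx ← to T-∧ x∈S∧h = (proj₁ (S⊆ x x∈S) , hx) , proj₂ (S⊆ x x∈S)
  diagonal-count (bob g l r) A B S correct S⊆ = split-count S g {depth l} {depth r}
    (diagonal-count l A (λ y → B y × T (not (g y))) (λ x → S x ∧ not (g x))
      (λ x y Ax (By , ¬gy) → subst (ValidOutput (suc d) x y) (if-T-not ¬gy) (correct x y Ax By)) (restrict (not ∘ g)))
    (diagonal-count r A (λ y → B y × T (g y)) (λ x → S x ∧ g x)
      (λ x y Ax (By , gy) → subst (ValidOutput (suc d) x y) (if-T gy) (correct x y Ax By)) (restrict g))
    where
    restrict : ∀ h x → T (S x ∧ h x) → A x × (B x × T (h x))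
    restrict h x x∈S∧h with x∈S , hx ← to T-∧ x∈S∧h = proj₁ (S⊆ x x∈S) , proj₂ (S⊆ x x∈S) , hx

-- Kleitman's diameter theorem, weak form

-- Down-compression in coordinate k: a point with x_k = 1 moves to x_k = 0 unless that point is already in F.
compress : ∀ {n} → Fin n → Family n → Family n
compress zero    F (false ∷ x) = F (false ∷ x) ∨ F (true ∷ x)
compress zero    F (true ∷ x)  = F (true ∷ x) ∧ F (false ∷ x)
compress (suc k) F (b ∷ x)     = compress k (F ∘ (b ∷_)) x

DownAt : ∀ {n} → Fin n → Family n → Set
DownAt zero    F = ∀ x → T (F (true ∷ x)) → T (F (false ∷ x))
DownAt (suc k) F = ∀ b → DownAt k (F ∘ (b ∷_))

count-compress : ∀ {n} (k : Fin n) F → count n (compress k F) ≡ count n F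
count-compress {suc n} zero F = count-∨+count-∧ n (F ∘ (false ∷_)) (F ∘ (true ∷_))
count-compress {suc n} (suc k) F = cong₂ _+_ (count-compress k _) (count-compress k _)

compress-down : ∀ {n} (k : Fin n) F → DownAt k (compress k F)
compress-down zero    F x x∈ = from (T-∨ {F (false ∷ x)}) (inj₂ (proj₁ (to (T-∧ {F (true ∷ x)}) x∈)))
compress-down (suc k) F b    = compress-down k (F ∘ (b ∷_))

compress-mono : ∀ {n} (k : Fin n) {F G : Family n} → (∀ x → T (F x) → T (G x)) →
                ∀ x → T (compress k F x) → T (compress k G x)
compress-mono zero {F} {G} F⊆G (false ∷ x) x∈ with to (T-∨ {F (false ∷ x)}) x∈
... | inj₁ p = from (T-∨ {G (false ∷ x)}) (inj₁ (F⊆G _ p))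
... | inj₂ p = from (T-∨ {G (false ∷ x)}) (inj₂ (F⊆G _ p))
compress-mono zero {F} {G} F⊆G (true ∷ x)  x∈ with p , q ← to (T-∧ {F (true ∷ x)}) x∈ =
  from (T-∧ {G (true ∷ x)}) (F⊆G _ p , F⊆G _ q)
compress-mono (suc k) F⊆G (b ∷ x)     x∈ = compress-mono k (F⊆G ∘ (b ∷_)) x x∈

down-∨ : ∀ {n} (j : Fin n) {F G : Family n} → DownAt j F → DownAt j G → DownAt j (λ x → F x ∨ G x)
down-∨ zero {F} {G} dF dG x x∈ with to (T-∨ {F (true ∷ x)}) x∈
... | inj₁ p = from (T-∨ {F (false ∷ x)}) (inj₁ (dF x p))
... | inj₂ p = from (T-∨ {F (false ∷ x)}) (inj₂ (dG x p))
down-∨ (suc j) dF dG b = down-∨ j (dF b) (dG b)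

down-∧ : ∀ {n} (j : Fin n) {F G : Family n} → DownAt j F → DownAt j G → DownAt j (λ x → F x ∧ G x)
down-∧ zero {F} {G} dF dG x x∈ with p , q ← to (T-∧ {F (true ∷ x)}) x∈ =
  from (T-∧ {F (false ∷ x)}) (dF x p , dG x q)
down-∧ (suc j) dF dG b = down-∧ j (dF b) (dG b)

compress-preserves-down : ∀ {n} (k j : Fin n) {F} → DownAt j F → DownAt j (compress k F)
compress-preserves-down zero    zero    {F} _  = compress-down zero F
compress-preserves-down zero    (suc j)     dF false = down-∨ j (dF false) (dF true)
compress-preserves-down zero    (suc j)     dF true  = down-∧ j (dF true) (dF false)
compress-preserves-down (suc k) zero        dF x     = compress-mono k dF x
compress-preserves-down (suc k) (suc j)     dF b     = compress-preserves-down k j (dF b)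

-- e accounts for the coordinates already split off when recursing into the tails.
CrossDiameter≤ : ∀ {n} → ℕ → ℕ → Family n → Family n → Set
CrossDiameter≤ e d F G = ∀ x y → T (F x) → T (G y) → e + hamming x y ≤ d

private
  some-value : ∀ (f : Bool → Bool) → T (f false ∨ f true) → ∃ λ β → T (f β)
  some-value f p with to (T-∨ {f false}) p
  ... | inj₁ f₀ = false , f₀
  ... | inj₂ f₁ = true , f₁

  every-value : ∀ (f : Bool → Bool) → T (f true ∧ f false) → ∀ β → T (f β)
  every-value f p true  = proj₁ (to (T-∧ {f true}) p)
  every-value f p false = proj₂ (to (T-∧ {f true}) p)

  xor-not : ∀ β → 𝟙 (β xor not β) ≡ 1
  xor-not true  = refl
  xor-not false = refl

  xor-not′ : ∀ β → 𝟙 (not β xor β) ≡ 1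
  xor-not′ true  = refl
  xor-not′ false = refl

compress₀-witnesses : ∀ {n} (F G : Family (suc n)) b c x y →
                      T (compress zero F (b ∷ x)) → T (compress zero G (c ∷ y)) →
                      ∃₂ λ β γ → T (F (β ∷ x)) × T (G (γ ∷ y)) × 𝟙 (b xor c) ≤ 𝟙 (β xor γ)
compress₀-witnesses F G false false x y p q
  with β , Fβ ← some-value (λ β → F (β ∷ x)) p | γ , Gγ ← some-value (λ γ → G (γ ∷ y)) q =
  β , γ , Fβ , Gγ , z≤n
compress₀-witnesses F G true  true  x y p q =
  true , true , every-value (λ β → F (β ∷ x)) p true , every-value (λ γ → G (γ ∷ y)) q true , z≤n
compress₀-witnesses F G false true  x y p q with β , Fβ ← some-value (λ β → F (β ∷ x)) p =
  β , not β , Fβ , every-value (λ γ → G (γ ∷ y)) q (not β) , ≤-reflexive (sym (xor-not β))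
compress₀-witnesses F G true  false x y p q with γ , Gγ ← some-value (λ γ → G (γ ∷ y)) q =
  not γ , γ , every-value (λ β → F (β ∷ x)) p (not γ) , Gγ , ≤-reflexive (sym (xor-not′ γ))

compress-cross-diameter : ∀ {n} (k : Fin n) e d {F G : Family n} → CrossDiameter≤ e d F G →
                          CrossDiameter≤ e d (compress k F) (compress k G)
compress-cross-diameter (suc k) e d {F} {G} within (b ∷ x) (c ∷ y) x∈ y∈ = begin
  e + hamming (b ∷ x) (c ∷ y)         ≡⟨ cong (e +_) (hamming-∷ b c x y) ⟩
  e + (𝟙 (b xor c) + hamming x y)     ≡⟨ sym (+-assoc e _ _) ⟩
  e + 𝟙 (b xor c) + hamming x y       ≤⟨ compress-cross-diameter k (e + 𝟙 (b xor c)) d within′ x y x∈ y∈ ⟩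
  d                                   ∎
  where
  open ≤-Reasoning
  within′ : CrossDiameter≤ (e + 𝟙 (b xor c)) d (F ∘ (b ∷_)) (G ∘ (c ∷_))
  within′ x′ y′ p q = ≤-trans (≤-reflexive (trans (+-assoc e _ _) (cong (e +_) (sym (hamming-∷ b c x′ y′)))))
                              (within (b ∷ x′) (c ∷ y′) p q)
compress-cross-diameter zero e d {F} {G} within (b ∷ x) (c ∷ y) x∈ y∈
  with β , γ , Fβ , Gγ , b⊕c≤β⊕γ ← compress₀-witnesses F G b c x y x∈ y∈ = begin
  e + hamming (b ∷ x) (c ∷ y)         ≡⟨ cong (e +_) (hamming-∷ b c x y) ⟩
  e + (𝟙 (b xor c) + hamming x y)     ≤⟨ +-monoʳ-≤ e (+-monoˡ-≤ (hamming x y) b⊕c≤β⊕γ) ⟩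
  e + (𝟙 (β xor γ) + hamming x y)     ≡⟨ cong (e +_) (sym (hamming-∷ β γ x y)) ⟩
  e + hamming (β ∷ x) (γ ∷ y)         ≤⟨ within (β ∷ x) (γ ∷ y) Fβ Gγ ⟩
  d                                   ∎
  where open ≤-Reasoning

compress-all : ∀ {n} → List (Fin n) → Family n → Family n
compress-all ks F = foldr compress F ks

count-compress-all : ∀ {n} ks (F : Family n) → count n (compress-all ks F) ≡ count n F
count-compress-all []       F = refl
count-compress-all (k ∷ ks) F = trans (count-compress k _) (count-compress-all ks F)

compress-all-diameter : ∀ {n} ks d {F : Family n} → DiameterAtMost d F → DiameterAtMost d (compress-all ks F)
compress-all-diameter []       d F≤d = F≤d
compress-all-diameter (k ∷ ks) d F≤d = compress-cross-diameter k 0 d (compress-all-diameter ks d F≤d)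

compress-all-down : ∀ {n} ks (F : Family n) {j} → j ∈ ks → DownAt j (compress-all ks F)
compress-all-down (k ∷ ks) F (here refl) = compress-down k _
compress-all-down (k ∷ ks) F (there j∈ks) = compress-preserves-down k _ (compress-all-down ks F j∈ks)

down-closed-─ : ∀ {n} (D : Family n) → (∀ j → DownAt j D) → ∀ x y → T (D y) → T (D (y ─ x))
down-closed-─ {zero}  D down []          []          y∈ = y∈
down-closed-─ {suc n} D down (false ∷ x) (b ∷ y)     y∈ =
  down-closed-─ (D ∘ (b ∷_)) (λ j → down (suc j) b) x y y∈
down-closed-─ {suc n} D down (true ∷ x)  (false ∷ y) y∈ =
  down-closed-─ (D ∘ (false ∷_)) (λ j → down (suc j) false) x y y∈
down-closed-─ {suc n} D down (true ∷ x)  (true ∷ y)  y∈ =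
  down-closed-─ (D ∘ (false ∷_)) (λ j → down (suc j) false) x y (down zero y y∈)

hamming-─ : ∀ {n} (x y : Vec Bool n) → hamming x (y ─ x) ≡ ∣ x ∪ y ∣
hamming-─ []          []          = refl
hamming-─ (true ∷ x)  (true ∷ y)  = cong suc (hamming-─ x y)
hamming-─ (true ∷ x)  (false ∷ y) = cong suc (hamming-─ x y)
hamming-─ (false ∷ x) (true ∷ y)  = cong suc (hamming-─ x y)
hamming-─ (false ∷ x) (false ∷ y) = hamming-─ x y

UnionAtMost : ∀ {n} → ℕ → Family n → Set
UnionAtMost d F = ∀ x y → T (F x) → T (F y) → ∣ x ∪ y ∣ ≤ d

-- In a down-set, y ─ x is a member with hamming x (y ─ x) = ∣ x ∪ y ∣.
∃-down-compression : ∀ n d (S : Family n) → DiameterAtMost d S →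
                     ∃ λ (D : Family n) → count n D ≡ count n S × UnionAtMost d D
∃-down-compression n d S S≤d = D , count-compress-all (allFin n) S , union≤d
  where
  D = compress-all (allFin n) S
  union≤d : UnionAtMost d D
  union≤d x y x∈ y∈ = ≤-trans (≤-reflexive (sym (hamming-─ x y)))
    (compress-all-diameter (allFin n) d S≤d x (y ─ x) x∈
      (down-closed-─ D (λ j → compress-all-down (allFin n) S (∈-allFin j)) x y y∈))

-- A family on {0,1}^(suc n), split by its first coordinate.
Family₂ : ℕ → Set
Family₂ n = Bool → Family n

tail₂ : ∀ {n} → Family₂ (suc n) → Bool → Family₂ n
tail₂ P c b z = P b (c ∷ z)

size₂ : ∀ {n} → Family₂ n → ℕ
size₂ {n} P = count n (P false) + count n (P true)

-- Katona's shift: a set containing the first element but not the k-th trades the former for the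
-- latter, unless the resulting set is already present.
shift : ∀ {n} → Fin n → Family₂ n → Family₂ n
shift zero    P false (false ∷ z) = P false (false ∷ z)
shift zero    P true  (true ∷ z)  = P true (true ∷ z)
shift zero    P false (true ∷ z)  = P false (true ∷ z) ∨ P true (false ∷ z)
shift zero    P true  (false ∷ z) = P true (false ∷ z) ∧ P false (true ∷ z)
shift (suc k) P b     (c ∷ z)     = shift k (tail₂ P c) b z

Stable : ∀ {n} → Fin n → Family₂ n → Set
Stable zero    P = ∀ z → T (P true (false ∷ z)) → T (P false (true ∷ z))
Stable (suc k) P = ∀ c → Stable k (tail₂ P c)

size-shift : ∀ {n} (k : Fin n) P → size₂ (shift k P) ≡ size₂ P
size-shift {suc n} zero P = begin
  (c₀₀ + c₀₁′) + (c₁₀′ + c₁₁)   ≡⟨ regroup c₀₀ c₀₁′ c₁₀′ c₁₁ ⟩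
  c₀₀ + (c₀₁′ + c₁₀′) + c₁₁     ≡⟨ cong (λ m → c₀₀ + m + c₁₁) (count-∨+count-∧ n (tail₂ P true false) (tail₂ P false true)) ⟩
  c₀₀ + (c₀₁ + c₁₀) + c₁₁       ≡⟨ sym (regroup c₀₀ c₀₁ c₁₀ c₁₁) ⟩
  (c₀₀ + c₀₁) + (c₁₀ + c₁₁)     ∎
  where
  open ≡-Reasoning
  c₀₀ = count n (λ z → P false (false ∷ z))
  c₀₁ = count n (λ z → P false (true ∷ z))
  c₁₀ = count n (λ z → P true (false ∷ z))
  c₁₁ = count n (λ z → P true (true ∷ z))
  c₀₁′ = count n (λ z → P false (true ∷ z) ∨ P true (false ∷ z))
  c₁₀′ = count n (λ z → P true (false ∷ z) ∧ P false (true ∷ z))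
  regroup : ∀ a b c d → (a + b) + (c + d) ≡ a + (b + c) + d
  regroup = solve-∀
size-shift {suc n} (suc k) P = begin
  size₂ (shift (suc k) P)
    ≡⟨ +-interchange (count n (shift k (tail₂ P false) false)) _ _ _ ⟩
  size₂ (shift k (tail₂ P false)) + size₂ (shift k (tail₂ P true))
    ≡⟨ cong₂ _+_ (size-shift k (tail₂ P false)) (size-shift k (tail₂ P true)) ⟩
  size₂ (tail₂ P false) + size₂ (tail₂ P true)
    ≡⟨ +-interchange (count n (tail₂ P false false)) _ _ _ ⟩
  size₂ P ∎
  where open ≡-Reasoning

shift-grows-false : ∀ {n} (k : Fin n) P x → T (P false x) → T (shift k P false x)
shift-grows-false zero    P (false ∷ z) p = p
shift-grows-false zero    P (true ∷ z)  p = from (T-∨ {P false (true ∷ z)}) (inj₁ p)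
shift-grows-false (suc k) P (c ∷ z)     p = shift-grows-false k (tail₂ P c) z p

shift-shrinks-true : ∀ {n} (k : Fin n) P x → T (shift k P true x) → T (P true x)
shift-shrinks-true zero    P (false ∷ z) p = proj₁ (to (T-∧ {P true (false ∷ z)}) p)
shift-shrinks-true zero    P (true ∷ z)  p = p
shift-shrinks-true (suc k) P (c ∷ z)     p = shift-shrinks-true k (tail₂ P c) z p

shift-stable : ∀ {n} (k : Fin n) P → Stable k (shift k P)
shift-stable zero    P z p = from (T-∨ {P false (true ∷ z)}) (inj₁ (proj₂ (to (T-∧ {P true (false ∷ z)}) p)))
shift-stable (suc k) P c   = shift-stable k (tail₂ P c)

stable-mono : ∀ {n} (j : Fin n) {P Q : Family₂ n} →
              (∀ x → T (P false x) → T (Q false x)) → (∀ x → T (Q true x) → T (P true x)) →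
              Stable j P → Stable j Q
stable-mono zero    P⊆Q Q⊆P stable z = P⊆Q _ ∘ stable z ∘ Q⊆P _
stable-mono (suc j) P⊆Q Q⊆P stable c = stable-mono j (P⊆Q ∘ (c ∷_)) (Q⊆P ∘ (c ∷_)) (stable c)

shift-preserves-stable : ∀ {n} (k j : Fin n) {P} → Stable j P → Stable j (shift k P)
shift-preserves-stable k j {P} = stable-mono j (shift-grows-false k P) (shift-shrinks-true k P)

∣∷∪∷∣ : ∀ {n} a b (x y : Vec Bool n) → ∣ (a ∷ x) ∪ (b ∷ y) ∣ ≡ 𝟙 (a ∨ b) + ∣ x ∪ y ∣
∣∷∪∷∣ true  true  x y = refl
∣∷∪∷∣ true  false x y = refl
∣∷∪∷∣ false true  x y = refl
∣∷∪∷∣ false false x y = refl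

UnionWithin₂ : ∀ {n} → ℕ → ℕ → Family₂ n → Family₂ n → Set
UnionWithin₂ e d P Q = ∀ b b′ x y → T (P b x) → T (Q b′ y) → e + (𝟙 (b ∨ b′) + ∣ x ∪ y ∣) ≤ d

shift₀-source : ∀ {n} (P : Family₂ (suc n)) b c z → T (shift zero P b (c ∷ z)) →
                T (P b (c ∷ z)) ⊎ (b ≡ false × c ≡ true × T (P true (false ∷ z)))
shift₀-source P false false z p = inj₁ p
shift₀-source P true  true  z p = inj₁ p
shift₀-source P true  false z p = inj₁ (proj₁ (to (T-∧ {P true (false ∷ z)}) p))
shift₀-source P false true  z p with to (T-∨ {P false (true ∷ z)}) p
... | inj₁ kept  = inj₁ kept
... | inj₂ moved = inj₂ (refl , refl , moved)

weight : Bool → Bool → Bool → Bool → ℕ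
weight b c b′ c′ = 𝟙 (b ∨ b′) + 𝟙 (c ∨ c′)

∣∷∪∷∣-weight : ∀ {n} b b′ c c′ (x y : Vec Bool n) →
               𝟙 (b ∨ b′) + ∣ (c ∷ x) ∪ (c′ ∷ y) ∣ ≡ weight b c b′ c′ + ∣ x ∪ y ∣
∣∷∪∷∣-weight b b′ c c′ x y =
  trans (cong (𝟙 (b ∨ b′) +_) (∣∷∪∷∣ c c′ x y)) (sym (+-assoc (𝟙 (b ∨ b′)) (𝟙 (c ∨ c′)) ∣ x ∪ y ∣))

Witnesses : ∀ {n} → Family₂ (suc n) → Family₂ (suc n) → Bool → Bool → Bool → Bool → Vec Bool n → Vec Bool n → Set
Witnesses P Q b c b′ c′ x y =
  ∃₂ λ β γ → ∃₂ λ β′ γ′ → T (P β (γ ∷ x)) × T (Q β′ (γ′ ∷ y)) × weight b c b′ c′ ≤ weight β γ β′ γ′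

private
  moved-left : ∀ {n} (P Q : Family₂ (suc n)) b′ c′ x y → T (P true (false ∷ x)) →
               T (shift zero Q b′ (c′ ∷ y)) → T (Q b′ (c′ ∷ y)) → Witnesses P Q false true b′ c′ x y
  moved-left P Q false false x y p _ q = true , false , false , false , p , q , ≤-refl
  moved-left P Q true  true  x y p _ q = true , false , true  , true  , p , q , ≤-refl
  moved-left P Q false true  x y p _ q = true , false , false , true  , p , q , ≤ᵇ⇒≤ 1 2 tt
  moved-left P Q true  false x y p q _ =
    true , false , false , true , p , proj₂ (to (T-∧ {Q true (false ∷ y)}) q) , ≤-refl

  moved-right : ∀ {n} (P Q : Family₂ (suc n)) b c x y → T (Q true (false ∷ y)) →
                T (shift zero P b (c ∷ x)) → T (P b (c ∷ x)) → Witnesses P Q b c false true x y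
  moved-right P Q false false x y q _ p = false , false , true , false , p , q , ≤-refl
  moved-right P Q true  true  x y q _ p = true  , true  , true , false , p , q , ≤-refl
  moved-right P Q false true  x y q _ p = false , true  , true , false , p , q , ≤ᵇ⇒≤ 1 2 tt
  moved-right P Q true  false x y q p _ =
    false , true , true , false , proj₂ (to (T-∧ {P true (false ∷ x)}) p) , q , ≤-refl

shift₀-witnesses : ∀ {n} (P Q : Family₂ (suc n)) b c b′ c′ x y →
                   T (shift zero P b (c ∷ x)) → T (shift zero Q b′ (c′ ∷ y)) → Witnesses P Q b c b′ c′ x y
shift₀-witnesses P Q b c b′ c′ x y p q with shift₀-source P b c x p | shift₀-source Q b′ c′ y q
... | inj₁ p′                  | inj₁ q′                  = b , c , b′ , c′ , p′ , q′ , ≤-refl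
... | inj₂ (refl , refl , p′) | inj₂ (refl , refl , q′) = true , false , true , false , p′ , q′ , ≤-refl
... | inj₂ (refl , refl , p′) | inj₁ q′                  = moved-left P Q b′ c′ x y p′ q q′
... | inj₁ p′                  | inj₂ (refl , refl , q′) = moved-right P Q b c x y q′ p p′

shift-union : ∀ {n} (k : Fin n) e d {P Q : Family₂ n} →
              UnionWithin₂ e d P Q → UnionWithin₂ e d (shift k P) (shift k Q)
shift-union zero e d {P} {Q} within b b′ (c ∷ x) (c′ ∷ y) p q
  with β , γ , β′ , γ′ , p′ , q′ , w≤w′ ← shift₀-witnesses P Q b c b′ c′ x y p q = begin
  e + (𝟙 (b ∨ b′) + ∣ (c ∷ x) ∪ (c′ ∷ y) ∣)    ≡⟨ cong (e +_) (∣∷∪∷∣-weight b b′ c c′ x y) ⟩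
  e + (weight b c b′ c′ + ∣ x ∪ y ∣)           ≤⟨ +-monoʳ-≤ e (+-monoˡ-≤ ∣ x ∪ y ∣ w≤w′) ⟩
  e + (weight β γ β′ γ′ + ∣ x ∪ y ∣)           ≡⟨ cong (e +_) (sym (∣∷∪∷∣-weight β β′ γ γ′ x y)) ⟩
  e + (𝟙 (β ∨ β′) + ∣ (γ ∷ x) ∪ (γ′ ∷ y) ∣)    ≤⟨ within β β′ (γ ∷ x) (γ′ ∷ y) p′ q′ ⟩
  d                                            ∎
  where open ≤-Reasoning
shift-union (suc k) e d {P} {Q} within b b′ (c ∷ x) (c′ ∷ y) p q =
  ≤-trans (≤-reflexive (peel b b′ x y))
          (shift-union k (e + 𝟙 (c ∨ c′)) d {tail₂ P c} {tail₂ Q c′} within′ b b′ x y p q)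
  where
  peel : ∀ β β′ x′ y′ → e + (𝟙 (β ∨ β′) + ∣ (c ∷ x′) ∪ (c′ ∷ y′) ∣)
                        ≡ e + 𝟙 (c ∨ c′) + (𝟙 (β ∨ β′) + ∣ x′ ∪ y′ ∣)
  peel β β′ x′ y′ = trans (cong (λ m → e + (𝟙 (β ∨ β′) + m)) (∣∷∪∷∣ c c′ x′ y′))
                          (rearrange e (𝟙 (β ∨ β′)) (𝟙 (c ∨ c′)) ∣ x′ ∪ y′ ∣)
    where
    rearrange : ∀ e w u s → e + (w + (u + s)) ≡ e + u + (w + s)
    rearrange = solve-∀
  within′ : UnionWithin₂ (e + 𝟙 (c ∨ c′)) d (tail₂ P c) (tail₂ Q c′)
  within′ β β′ x′ y′ p′ q′ = ≤-trans (≤-reflexive (sym (peel β β′ x′ y′))) (within β β′ (c ∷ x′) (c′ ∷ y′) p′ q′)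

shift-all : ∀ {n} → List (Fin n) → Family₂ n → Family₂ n
shift-all ks P = foldr shift P ks

size-shift-all : ∀ {n} ks (P : Family₂ n) → size₂ (shift-all ks P) ≡ size₂ P
size-shift-all []       P = refl
size-shift-all (k ∷ ks) P = trans (size-shift k _) (size-shift-all ks P)

shift-all-union : ∀ {n} ks d {P : Family₂ n} →
                  UnionWithin₂ 0 d P P → UnionWithin₂ 0 d (shift-all ks P) (shift-all ks P)
shift-all-union []       d within = within
shift-all-union (k ∷ ks) d within = shift-union k 0 d (shift-all-union ks d within)

shift-all-stable : ∀ {n} ks (P : Family₂ n) {j} → j ∈ ks → Stable j (shift-all ks P)
shift-all-stable (k ∷ ks) P (here refl)  = shift-stable k _
shift-all-stable (k ∷ ks) P (there j∈ks) = shift-preserves-stable k _ (shift-all-stable ks P j∈ks)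

-- Stability lets a set containing the first element trade it for any element outside a ∪ a′.
fresh-coordinate : ∀ n (P : Family₂ n) → (∀ j → Stable j P) → ∀ a a′ → T (P true a) → ∣ a ∪ a′ ∣ < n →
                   ∃ λ â → T (P false â) × ∣ â ∪ a′ ∣ ≡ suc ∣ a ∪ a′ ∣
fresh-coordinate (suc n) P stable (false ∷ a) (false ∷ a′) a∈ _ = true ∷ a , stable zero a a∈ , refl
fresh-coordinate (suc n) P stable (true ∷ a)  (c′ ∷ a′)    a∈ (s≤s ∣a∪a′∣<n)
  with â , â∈ , ∣â∪a′∣≡ ← fresh-coordinate n (tail₂ P true) (λ j → stable (suc j) true) a a′ a∈ ∣a∪a′∣<n =
  true ∷ â , â∈ , cong suc ∣â∪a′∣≡
fresh-coordinate (suc n) P stable (false ∷ a) (true ∷ a′)  a∈ (s≤s ∣a∪a′∣<n)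
  with â , â∈ , ∣â∪a′∣≡ ← fresh-coordinate n (tail₂ P false) (λ j → stable (suc j) false) a a′ a∈ ∣a∪a′∣<n =
  false ∷ â , â∈ , cong suc ∣â∪a′∣≡

-- After shifting, the sets containing the first element have pairwise unions of size ≤ d − 2.
katona-step : ∀ n d r (F : Family (suc n)) → UnionAtMost d F → d ≤ n → d ≤ suc (r + r) →
              (∀ d′ r′ (G : Family n) → UnionAtMost d′ G → d′ ≤ suc (r′ + r′) → count n G ≤ 2 * V₂ n r′) →
              count (suc n) F ≤ 2 * V₂ (suc n) r
katona-step n d r F F≤d d≤n d≤2r+1 katona-n =
  ≤-trans (≤-reflexive (sym (size-shift-all (allFin n) (λ b x → F (b ∷ x))))) (by-radius r d≤2r+1)
  where
  Q = shift-all (allFin n) (λ b x → F (b ∷ x))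
  union : UnionWithin₂ 0 d Q Q
  union = shift-all-union (allFin n) d
            (λ b b′ x y p q → ≤-trans (≤-reflexive (sym (∣∷∪∷∣ b b′ x y))) (F≤d (b ∷ x) (b′ ∷ y) p q))
  stable : ∀ j → Stable j Q
  stable j = shift-all-stable (allFin n) _ (∈-allFin j)
  false-part : UnionAtMost d (Q false)
  false-part = union false false
  true-part : ∀ a a′ → T (Q true a) → T (Q true a′) → 2 + ∣ a ∪ a′ ∣ ≤ d
  true-part a a′ a∈ a′∈ with ∣ a ∪ a′ ∣ <? n
  ... | yes ∣a∪a′∣<n
    with â , â∈ , ∣â∪a′∣≡ ← fresh-coordinate n Q stable a a′ a∈ ∣a∪a′∣<n =
    ≤-trans (≤-reflexive (cong suc (sym ∣â∪a′∣≡))) (union false true â a′ â∈ a′∈)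
  ... | no ∣a∪a′∣≮n = ⊥-elim (<⇒≱ (s≤s (≤-trans d≤n (≮⇒≥ ∣a∪a′∣≮n))) (union true true a a′ a∈ a′∈))
  by-radius : ∀ r → d ≤ suc (r + r) → size₂ Q ≤ 2 * V₂ (suc n) r
  by-radius zero d≤1 = +-mono-≤ (katona-n d 0 (Q false) false-part d≤1) (≤-reflexive no-true-part)
    where
    no-true-part : count n (Q true) ≡ 0
    no-true-part = count-empty n (Q true) (λ a a∈ → <⇒≱ (≤-trans (s≤s (s≤s z≤n)) (true-part a a a∈ a∈)) d≤1)
  by-radius (suc r) d≤2r+3 = begin
    count n (Q false) + count n (Q true)
      ≤⟨ +-mono-≤ (katona-n d (suc r) (Q false) false-part d≤2r+3)
                  (katona-n (d ∸ 2) r (Q true) true-part′ d∸2≤) ⟩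
    2 * V₂ n (suc r) + 2 * V₂ n r
      ≡⟨ sym (*-distribˡ-+ 2 (V₂ n (suc r)) (V₂ n r)) ⟩
    2 * (V₂ n (suc r) + V₂ n r)
      ≡⟨ cong (2 *_) (sym (V₂-pascal n r)) ⟩
    2 * V₂ (suc n) (suc r) ∎
    where
    open ≤-Reasoning
    true-part′ : UnionAtMost (d ∸ 2) (Q true)
    true-part′ a a′ a∈ a′∈ = m+n≤o⇒m≤o∸n _ (subst (_≤ d) (+-comm 2 _) (true-part a a′ a∈ a′∈))
    d∸2≤ : d ∸ 2 ≤ suc (r + r)
    d∸2≤ = ≤-trans (∸-monoˡ-≤ 2 d≤2r+3) (≤-reflexive (+-suc r r))

katona : ∀ n d r (F : Family n) → UnionAtMost d F → d ≤ suc (r + r) → count n F ≤ 2 * V₂ n r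
katona zero    d r F _   _      = ≤-trans (count≤2^n 0 F) (2^n≤2*V₂ 0 r z≤n)
katona (suc n) d r F F≤d d≤2r+1 with d ≤? n
... | yes d≤n = katona-step n d r F F≤d d≤n d≤2r+1 (katona n)
... | no  d≰n = ≤-trans (count≤2^n (suc n) F) (2^n≤2*V₂ (suc n) r (≤-trans (≰⇒> d≰n) d≤2r+1))

kleitman : ∀ n d r (S : Family n) → DiameterAtMost d S → d ≤ suc (r + r) → count n S ≤ 2 * V₂ n r
kleitman n d r S S≤d d≤2r+1 with D , count-D≡ , D≤d ← ∃-down-compression n d S S≤d =
  ≤-trans (≤-reflexive (sym count-D≡)) (katona n d r D D≤d d≤2r+1)

-- The lower bound and the theorem

lower-bound : ∀ n t → 1 ≤ n → 1 ≤ t → ∀ (P : Protocol (Vec Bool n) (Vec Bool n)) → ComputesGHD n t P →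
              2 ^ n ≤ 2 ^ depth P * V₂ n (t / 2) * (2 * n) ^ 6
lower-bound n (suc t′) 1≤n _ P computes = begin
  2 ^ n                                  ≡⟨ sym (trans (∑-const n 1) (*-identityʳ _)) ⟩
  count n (λ _ → true)                   ≤⟨ diagonal-count t′ (2 * V₂ n ρ) small P (λ _ → ⊤) (λ _ → ⊤) (λ _ → true)
                                                           (λ x y _ _ → computes x y) (λ _ _ → tt , tt) ⟩
  2 ^ depth P * (2 * V₂ n ρ)             ≡⟨ x∙yz≈xz∙y (2 ^ depth P) 2 (V₂ n ρ) ⟩
  2 ^ depth P * V₂ n ρ * 2               ≤⟨ *-mono-≤ (*-monoʳ-≤ (2 ^ depth P) (V₂-mono-≤ n (/-monoˡ-≤ 2 (n≤1+n t′))))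
                                                     (≤-trans (≤ᵇ⇒≤ 2 64 tt) (^-monoˡ-≤ 6 (*-monoʳ-≤ 2 1≤n))) ⟩
  2 ^ depth P * V₂ n (suc t′ / 2) * (2 * n) ^ 6 ∎
  where
  open ≤-Reasoning
  ρ = t′ / 2
  small : ∀ S → DiameterAtMost t′ S → count n S ≤ 2 * V₂ n ρ
  small S S≤t′ = kleitman n t′ ρ S S≤t′ (proj₂ (half-bounds t′))

theorem3 : Σ ℕ λ C → ∀ (n t : ℕ) → 1 ≤ n → 1 ≤ t → t ≤ n →
    (Σ (Protocol (Vec Bool n) (Vec Bool n)) λ P → ComputesGHD n t P ×
        (2 ^ depth P * V₂ n (t / 2) ≤ 2 ^ n * (2 * n) ^ C))
    × (∀ (P : Protocol (Vec Bool n) (Vec Bool n)) → ComputesGHD n t P →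
        2 ^ n ≤ 2 ^ depth P * V₂ n (t / 2) * (2 * n) ^ C)
theorem3 = 6 , λ n t 1≤n 1≤t _ → upper-bound n t 1≤n 1≤t , lower-bound n t 1≤n 1≤t
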